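{- Let $M$ and $M'$ be matroids such that $M'$ is obtained from $M$ by a sequence of series minors and coloop contractions. Then $\mathbb{K}[\mathrm{Cyc}(M')]$ is an algebra retract of $\mathbb{K}[\mathrm{Cyc}(M)]$.
   Context: Throughout, matroids are finite and non-free (they have at least one circuit). $\mathbb{K}$ is a field. A cycle of a matroid $M$ is a disjoint union of (possibly zero) circuits; $\mathrm{Cyc}(M)$ is the set of cycles (containing $\emptyset$). The cycle algebra is $\mathbb{K}[\mathrm{Cyc}(M)]=\mathbb{K}[\mathbf{y}^C z: C\in\mathrm{Cyc}(M)]\subseteq\mathbb{K}[y_e,z: e\in E(M)]$, where $\mathbf{y}^C=\prod_{e\in C}y_e$; it is standard graded by $\deg z=1$, $\deg y_e=0$. A series contraction of $M$ is $M/e$ where $e$ lies in a $2$-element cocircuit of $M$; a series minor is obtained by a sequence of deletions and series contractions; a coloop contraction is $M/e$ with $e$ a coloop of $M$. For graded $\mathbb{K}$-algebras $A,B$, $A$ is an algebra retract of $B$ if there are homogeneous $\mathbb{K}$-algebra homomorphisms (not necessarily of degree $0$) $\iota:A\to B$ and $\gamma:B\to A$ with $\gamma\circ\iota=\mathrm{id}_A$. -}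

module Defs where

open import Level using (Level; _⊔_) renaming (suc to lsuc)
open import Data.Nat using (ℕ; zero; suc; _∸_; _<_; _≤_)
import Data.Nat as ℕ
import Data.Nat.Properties as ℕP
open import Data.Bool using (Bool; true; false; if_then_else_)
open import Data.Fin using (Fin)
open import Data.Fin.Subset using (Subset; _∪_; _∩_; _⊆_; _⊂_; ∣_∣; ⊥; ⊤; ∁; ⁅_⁆; _∈_; _∉_)
open import Data.Vec using (Vec; replicate; zipWith; insertAt)
import Data.Vec as Vec
import Data.Vec.Properties as VecP
open import Data.List using (List; []; _∷_; _++_; map; concatMap; length)
open import Data.List.Relation.Unary.All using (All)
open import Data.Product using (Σ; ∃; _×_; _,_; proj₁; proj₂)
import Data.Product.Properties as ProdP
open import Data.Sum using (_⊎_)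
open import Relation.Nullary using (¬_; yes; no)
open import Relation.Binary.PropositionalEquality using (_≡_; _≢_)
open import Algebra.Bundles using (CommutativeRing)

record Field (c ℓ : Level) : Set (lsuc (c ⊔ ℓ)) where
  field
    commutativeRing : CommutativeRing c ℓ
  open CommutativeRing commutativeRing public
  field
    1≉0     : ¬ (1# ≈ 0#)
    inverse : ∀ x → ¬ (x ≈ 0#) → Σ Carrier λ y → x * y ≈ 1#

record Matroid (n : ℕ) : Set where
  field
    rank        : Subset n → ℕ
    rank-bound  : ∀ X → rank X ≤ ∣ X ∣
    rank-mono   : ∀ X Y → X ⊆ Y → rank X ≤ rank Y
    rank-submod : ∀ X Y → rank (X ∪ Y) ℕ.+ rank (X ∩ Y) ≤ rank X ℕ.+ rank Y

open Matroid public

IndepR : ∀ {n} → (Subset n → ℕ) → Subset n → Set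
IndepR r X = r X ≡ ∣ X ∣

CircuitR : ∀ {n} → (Subset n → ℕ) → Subset n → Set
CircuitR r C = ¬ IndepR r C × (∀ Y → Y ⊂ C → IndepR r Y)

Circuit : ∀ {n} → Matroid n → Subset n → Set
Circuit M = CircuitR (rank M)

dualRank : ∀ {n} → Matroid n → Subset n → ℕ
dualRank M X = (∣ X ∣ ℕ.+ rank M (∁ X)) ∸ rank M ⊤

Cocircuit : ∀ {n} → Matroid n → Subset n → Set
Cocircuit M = CircuitR (dualRank M)

data Cycle {n} (M : Matroid n) : Subset n → Set where
  cyc-∅ : Cycle M ⊥
  cyc-∪ : ∀ {C D} → Circuit M C → Cycle M D → C ∩ D ≡ ⊥ → Cycle M (C ∪ D)

NonFree : ∀ {n} → Matroid n → Set
NonFree M = ∃ λ C → Circuit M C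

Coloop : ∀ {n} → Matroid n → Fin n → Set
Coloop M e = ∀ C → Circuit M C → e ∉ C

InSeriesPair : ∀ {n} → Matroid n → Fin n → Set
InSeriesPair M e = ∃ λ f → f ≢ e × Cocircuit M (⁅ e ⁆ ∪ ⁅ f ⁆)

-- M' = M \ e  (ground set Fin n identified with Fin (suc n) minus e)
IsDeletion : ∀ {n} → Matroid (suc n) → Fin (suc n) → Matroid n → Set
IsDeletion M e M' = ∀ X → rank M' X ≡ rank M (insertAt X e false)

IsContraction : ∀ {n} → Matroid (suc n) → Fin (suc n) → Matroid n → Set
IsContraction M e M' =
  ∀ X → rank M' X ≡ rank M (insertAt X e true) ∸ rank M ⁅ e ⁆

data Step {n} (M : Matroid (suc n)) (M' : Matroid n) : Set where
  deletion     : ∀ e → IsDeletion M e M' → Step M M'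
  seriesContr  : ∀ e → InSeriesPair M e → IsContraction M e M' → Step M M'
  coloopContr  : ∀ e → Coloop M e → IsContraction M e M' → Step M M'

data Reach : ∀ {n m} → Matroid n → Matroid m → Set where
  here : ∀ {n} {M : Matroid n} → Reach M M
  step : ∀ {n m} {M : Matroid (suc n)} {M₁ : Matroid n} {M' : Matroid m} →
         Step M M₁ → Reach M₁ M' → Reach M M'

-- Monomial subalgebras K[y^a z : a ∈ G] ⊆ K[y_1..y_n, z] (deg z = 1)

record MonAlg : Set₁ where
  field
    vars : ℕ
    Gen  : Set
    wt   : Gen → Vec ℕ vars     -- generator g ↦ y^(wt g) z

open MonAlg public

module Poly {c ℓ} (K : Field c ℓ) (A : MonAlg) where
  open Field K

  Mon : Set
  Mon = Vec ℕ (vars A) × ℕ     -- exponent of y's, exponent of z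

  mon : List (Gen A) → Mon
  mon []       = replicate (vars A) 0 , 0
  mon (g ∷ gs) = zipWith ℕ._+_ (wt A g) (proj₁ (mon gs)) , suc (proj₂ (mon gs))

  -- an element: a formal sum of c · ∏ generators
  Term : Set c
  Term = Carrier × List (Gen A)

  Elt : Set c
  Elt = List Term

  _≟M_ : (m m' : Mon) → Relation.Nullary.Dec (m ≡ m')
  _≟M_ = ProdP.≡-dec (VecP.≡-dec ℕP._≟_) ℕP._≟_

  coeff : Elt → Mon → Carrier
  coeff []             m = 0#
  coeff ((a , gs) ∷ p) m with mon gs ≟M m
  ... | yes _ = a + coeff p m
  ... | no  _ = coeff p m

  -- equality as elements of the polynomial ring
  _≈E_ : Elt → Elt → Set ℓ
  p ≈E q = ∀ m → coeff p m ≈ coeff q m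

  _+E_ : Elt → Elt → Elt
  _+E_ = _++_

  _*E_ : Elt → Elt → Elt
  p *E q = concatMap (λ t → map (λ u → (proj₁ t * proj₁ u , proj₂ t ++ proj₂ u)) q) p

  1E : Elt
  1E = (1# , []) ∷ []

  _·E_ : Carrier → Elt → Elt
  a ·E p = map (λ t → (a * proj₁ t , proj₂ t)) p

  -- homogeneous of degree i (degree = exponent of z)
  Homog : ℕ → Elt → Set (c ⊔ ℓ)
  Homog i p = Σ Elt λ q → (q ≈E p) × All (λ t → length (proj₂ t) ≡ i) q

module _ {c ℓ} (K : Field c ℓ) (A B : MonAlg) where
  private
    module PA = Poly K A
    module PB = Poly K B
  open Field K using (Carrier)

  record IsHomHom (f : PA.Elt → PB.Elt) : Set (c ⊔ ℓ) where
    field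
      cong  : ∀ p q → p PA.≈E q → f p PB.≈E f q
      hom-+ : ∀ p q → f (p PA.+E q) PB.≈E (f p PB.+E f q)
      hom-* : ∀ p q → f (p PA.*E q) PB.≈E (f p PB.*E f q)
      hom-1 : f PA.1E PB.≈E PB.1E
      hom-· : ∀ a p → f (a PA.·E p) PB.≈E (a PB.·E f p)
      homog : ∃ λ d → ∀ i p → PA.Homog i p → PB.Homog (d ℕ.* i) (f p)

module _ {c ℓ} (K : Field c ℓ) where
  AlgebraRetract : MonAlg → MonAlg → Set (c ⊔ ℓ)
  AlgebraRetract A B =
    Σ (Poly.Elt K A → Poly.Elt K B) λ ι →
    Σ (Poly.Elt K B → Poly.Elt K A) λ γ →
      IsHomHom K A B ι × IsHomHom K B A γ ×
      (∀ p → Poly._≈E_ K A (γ (ι p)) p)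

indicator : ∀ {n} → Subset n → Vec ℕ n
indicator = Vec.map (λ b → if b then 1 else 0)

-- the cycle algebra K[Cyc(M)] = K[y^C z : C ∈ Cyc(M)]
CycAlg : ∀ {n} → Matroid n → MonAlg
CycAlg {n} M = record
  { vars = n
  ; Gen  = Σ (Subset n) (Cycle M)
  ; wt   = λ C → indicator (proj₁ C)
  }

-- Each deletion or contraction of an element e yields a retract, and retracts compose.
-- Circuits of M₁ lift to circuits of M: to C itself for a deletion or a coloop contraction, and,
-- for a series contraction along {e, f}, to C + e or C according as f ∈ C or not; conversely,
-- removing e sends circuits of M to circuits of M₁ (for a deletion, those avoiding e). Both
-- maps preserve disjoint unions, so they act on cycles, and y^C z ↦ y^(lift C) z and
-- y_e ↦ 1 (y_e ↦ 0 for a deletion) are monomial homomorphisms whose composite is the identity.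
module Submission where

open import Defs

open import Function using (_∘_; id)
open import Data.Empty using (⊥-elim)
open import Data.Nat as ℕ using (ℕ; zero; suc; _≤_; _<_; _∸_; z≤n; s≤s)
import Data.Nat.Properties as ℕP
open import Data.Bool using (Bool; true; false; if_then_else_; _∨_; _∧_)
open import Data.Bool.Base using (f≤t; b≤b) renaming (_≤_ to _≤ᵇ_)
import Data.Bool.Properties as BoolP
open import Data.Fin as Fin using (Fin; punchIn; punchOut)
import Data.Fin.Properties as FinP
open import Data.Fin.Subset
  using (Subset; _∪_; _∩_; _⊆_; _⊂_; ∣_∣; ⊥; ⊤; ∁; ⁅_⁆; _∈_; _∉_; _─_; _-_)
import Data.Fin.Subset.Properties as SP
open import Data.Vec as Vec using (Vec; []; _∷_; here; there; replicate; zipWith; insertAt; removeAt; lookup)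
import Data.Vec.Properties as VecP
open import Data.Product using (∃; _×_; _,_; proj₁; proj₂)
open import Data.Sum using (inj₁; inj₂; [_,_]′)
open import Data.List as List using (List; []; _∷_; _++_; length)
import Data.List.Properties as ListP
open import Data.List.Relation.Unary.All using (All; []; _∷_)
open import Data.Maybe as Maybe using (Maybe; just; nothing)
import Data.Maybe.Properties as MaybeP
open import Relation.Nullary using (¬_; yes; no; Dec; does)
open import Relation.Nullary.Decidable using (_×-dec_; ¬?)
open import Relation.Binary.PropositionalEquality
  using (_≡_; _≢_; refl; sym; trans; cong; cong₂; subst; subst₂; module ≡-Reasoning)

private variable
  A B C : Set
  n : ℕ

zipWith-insertAt : (g : A → B → C) (u : Vec A n) (v : Vec B n) (e : Fin (suc n)) (a : A) (b : B) →
  zipWith g (insertAt u e a) (insertAt v e b) ≡ insertAt (zipWith g u v) e (g a b)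
zipWith-insertAt g u       v       Fin.zero    a b = refl
zipWith-insertAt g (x ∷ u) (y ∷ v) (Fin.suc e) a b = cong (g x y ∷_) (zipWith-insertAt g u v e a b)

insertAt-replicate : (x : A) (e : Fin (suc n)) → insertAt (replicate n x) e x ≡ replicate (suc n) x
insertAt-replicate             x Fin.zero    = refl
insertAt-replicate {n = suc n} x (Fin.suc e) = cong (x ∷_) (insertAt-replicate x e)

zipWith-removeAt : (g : A → B → C) (u : Vec A (suc n)) (v : Vec B (suc n)) (e : Fin (suc n)) →
  removeAt (zipWith g u v) e ≡ zipWith g (removeAt u e) (removeAt v e)
zipWith-removeAt g u v e = begin
  removeAt (zipWith g u v) e
    ≡⟨ cong₂ (λ u′ v′ → removeAt (zipWith g u′ v′) e)
             (sym (VecP.insertAt-removeAt u e)) (sym (VecP.insertAt-removeAt v e)) ⟩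
  removeAt (zipWith g (insertAt (removeAt u e) e _) (insertAt (removeAt v e) e _)) e
    ≡⟨ cong (λ w → removeAt w e) (zipWith-insertAt g (removeAt u e) (removeAt v e) e _ _) ⟩
  removeAt (insertAt (zipWith g (removeAt u e) (removeAt v e)) e _) e
    ≡⟨ VecP.removeAt-insertAt _ e _ ⟩
  zipWith g (removeAt u e) (removeAt v e) ∎
  where open ≡-Reasoning

removeAt-replicate : (x : A) (e : Fin (suc n)) → removeAt (replicate (suc n) x) e ≡ replicate n x
removeAt-replicate x e =
  trans (cong (λ w → removeAt w e) (sym (insertAt-replicate x e))) (VecP.removeAt-insertAt _ e x)

map-removeAt : (g : A → B) (u : Vec A (suc n)) (e : Fin (suc n)) →
  Vec.map g (removeAt u e) ≡ removeAt (Vec.map g u) e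
map-removeAt g u e = begin
  Vec.map g (removeAt u e)
    ≡⟨ VecP.removeAt-insertAt _ e _ ⟨
  removeAt (insertAt (Vec.map g (removeAt u e)) e (g (lookup u e))) e
    ≡⟨ cong (λ w → removeAt w e) (VecP.map-insertAt g _ _ e) ⟨
  removeAt (Vec.map g (insertAt (removeAt u e) e (lookup u e))) e
    ≡⟨ cong (λ w → removeAt (Vec.map g w) e) (VecP.insertAt-removeAt u e) ⟩
  removeAt (Vec.map g u) e ∎
  where open ≡-Reasoning

insertAt-removeAt-lookup : (u : Vec A (suc n)) (e : Fin (suc n)) {a : A} →
  lookup u e ≡ a → u ≡ insertAt (removeAt u e) e a
insertAt-removeAt-lookup u e refl = sym (VecP.insertAt-removeAt u e)

x∈p─q⇒x∉q : (p q : Subset n) {x : Fin n} → x ∈ p ─ q → x ∉ q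
x∈p─q⇒x∉q (_ ∷ p) (true ∷ q) {Fin.zero}  ()        here
x∈p─q⇒x∉q (_ ∷ p) (_ ∷ q)    {Fin.suc x} (there h) (there h′) = x∈p─q⇒x∉q p q h h′

p⊆q⇒∣p∣+∣q─p∣≡∣q∣ : (p q : Subset n) → p ⊆ q → ∣ p ∣ ℕ.+ ∣ q ─ p ∣ ≡ ∣ q ∣
p⊆q⇒∣p∣+∣q─p∣≡∣q∣ []          []          _   = refl
p⊆q⇒∣p∣+∣q─p∣≡∣q∣ (true ∷ p)  (true ∷ q)  p⊆q = cong suc (p⊆q⇒∣p∣+∣q─p∣≡∣q∣ p q (SP.drop-∷-⊆ p⊆q))
p⊆q⇒∣p∣+∣q─p∣≡∣q∣ (true ∷ p)  (false ∷ q) p⊆q with p⊆q here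
... | ()
p⊆q⇒∣p∣+∣q─p∣≡∣q∣ (false ∷ p) (true ∷ q)  p⊆q =
  trans (ℕP.+-suc ∣ p ∣ _) (cong suc (p⊆q⇒∣p∣+∣q─p∣≡∣q∣ p q (SP.drop-∷-⊆ p⊆q)))
p⊆q⇒∣p∣+∣q─p∣≡∣q∣ (false ∷ p) (false ∷ q) p⊆q = p⊆q⇒∣p∣+∣q─p∣≡∣q∣ p q (SP.drop-∷-⊆ p⊆q)

x∈p⇒suc∣p-x∣≡∣p∣ : {p : Subset n} {x : Fin n} → x ∈ p → suc ∣ p - x ∣ ≡ ∣ p ∣
x∈p⇒suc∣p-x∣≡∣p∣ {p = p} {x} x∈p = trans (cong (ℕ._+ ∣ p - x ∣) (sym (SP.∣⁅x⁆∣≡1 x)))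
  (p⊆q⇒∣p∣+∣q─p∣≡∣q∣ ⁅ x ⁆ p (λ y∈ → subst (_∈ p) (sym (SP.x∈⁅y⁆⇒x≡y x y∈)) x∈p))

data PivotView (e : Fin (suc n)) : Fin (suc n) → Set where
  pivot : PivotView e e
  other : (j : Fin n) → PivotView e (punchIn e j)

pivotView : (e x : Fin (suc n)) → PivotView e x
pivotView e x with e FinP.≟ x
... | yes refl = pivot
... | no e≢x   = subst (PivotView e) (FinP.punchIn-punchOut e≢x) (other (punchOut e≢x))

module _ (X : Subset n) (e : Fin (suc n)) where

  pivot∈insertAt : e ∈ insertAt X e true
  pivot∈insertAt = VecP.lookup⇒[]= e _ (VecP.insertAt-lookup X e true)

  pivot∉insertAt : e ∉ insertAt X e false
  pivot∉insertAt e∈ with trans (sym (VecP.[]=⇒lookup e∈)) (VecP.insertAt-lookup X e false)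
  ... | ()

  punchIn∈insertAt⁺ : ∀ {b} j → j ∈ X → punchIn e j ∈ insertAt X e b
  punchIn∈insertAt⁺ {b} j j∈ =
    VecP.lookup⇒[]= _ _ (trans (VecP.insertAt-punchIn X e b j) (VecP.[]=⇒lookup j∈))

  punchIn∈insertAt⁻ : ∀ {b} j → punchIn e j ∈ insertAt X e b → j ∈ X
  punchIn∈insertAt⁻ {b} j j∈ =
    VecP.lookup⇒[]= _ _ (trans (sym (VecP.insertAt-punchIn X e b j)) (VecP.[]=⇒lookup j∈))

  ⁅pivot⁆⊆insertAt : ⁅ e ⁆ ⊆ insertAt X e true
  ⁅pivot⁆⊆insertAt x∈ = subst (_∈ insertAt X e true) (sym (SP.x∈⁅y⁆⇒x≡y e x∈)) pivot∈insertAt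

∣insertAt∣ : (X : Subset n) (e : Fin (suc n)) (b : Bool) →
  ∣ insertAt X e b ∣ ≡ (if b then suc ∣ X ∣ else ∣ X ∣)
∣insertAt∣ X           Fin.zero    true  = refl
∣insertAt∣ X           Fin.zero    false = refl
∣insertAt∣ (true ∷ X)  (Fin.suc e) true  = cong suc (∣insertAt∣ X e true)
∣insertAt∣ (true ∷ X)  (Fin.suc e) false = cong suc (∣insertAt∣ X e false)
∣insertAt∣ (false ∷ X) (Fin.suc e) b     = ∣insertAt∣ X e b

insertAt-⊆ : {X Y : Subset n} (e : Fin (suc n)) {b c : Bool} →
  X ⊆ Y → b ≤ᵇ c → insertAt X e b ⊆ insertAt Y e c
insertAt-⊆ {X = X} {Y} e X⊆Y b≤c {x} x∈ with pivotView e x | b≤c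
... | other j | _   = punchIn∈insertAt⁺ Y e j (X⊆Y (punchIn∈insertAt⁻ X e j x∈))
... | pivot   | f≤t = pivot∈insertAt Y e
... | pivot   | b≤b {true}  = pivot∈insertAt Y e
... | pivot   | b≤b {false} = ⊥-elim (pivot∉insertAt X e x∈)

insertAt-⊂ : {X Y : Subset n} (e : Fin (suc n)) {b c : Bool} →
  X ⊂ Y → b ≤ᵇ c → insertAt X e b ⊂ insertAt Y e c
insertAt-⊂ {X = X} {Y} e (X⊆Y , x , x∈Y , x∉X) b≤c =
  insertAt-⊆ e X⊆Y b≤c , punchIn e x , punchIn∈insertAt⁺ Y e x x∈Y , x∉X ∘ punchIn∈insertAt⁻ X e x

removeAt-⊆ : {Z : Subset (suc n)} {Y : Subset n} (e : Fin (suc n)) {c : Bool} →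
  Z ⊆ insertAt Y e c → removeAt Z e ⊆ Y
removeAt-⊆ {Z = Z} {Y} e Z⊆ {j} j∈ = punchIn∈insertAt⁻ Y e j (Z⊆ (subst (punchIn e j ∈_)
  (VecP.insertAt-removeAt Z e) (punchIn∈insertAt⁺ (removeAt Z e) e j j∈)))

removeAt-⊂ : {Z : Subset (suc n)} {Y : Subset n} (e : Fin (suc n)) {c : Bool} →
  Z ⊂ insertAt Y e c → lookup Z e ≡ c → removeAt Z e ⊂ Y
removeAt-⊂ {Z = Z} {Y} e {c} (Z⊆ , x , x∈ , x∉Z) Ze≡c with pivotView e x
... | pivot   = ⊥-elim (x∉Z (VecP.lookup⇒[]= e Z (trans Ze≡c
                  (trans (sym (VecP.insertAt-lookup Y e c)) (VecP.[]=⇒lookup x∈)))))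
... | other j = removeAt-⊆ e Z⊆ , j , punchIn∈insertAt⁻ Y e j x∈ ,
                  λ j∈ → x∉Z (subst (punchIn e j ∈_) (VecP.insertAt-removeAt Z e)
                                    (punchIn∈insertAt⁺ (removeAt Z e) e j j∈))

⊆insertAt-false⇒lookup≡false : {Z : Subset (suc n)} {Y : Subset n} (e : Fin (suc n)) →
  Z ⊆ insertAt Y e false → lookup Z e ≡ false
⊆insertAt-false⇒lookup≡false {Z = Z} {Y} e Z⊆ with lookup Z e in eq
... | false = refl
... | true  = ⊥-elim (pivot∉insertAt Y e (Z⊆ (VecP.lookup⇒[]= e Z eq)))

insertAt-true-pivot⊆insertAt-false : (X : Subset n) (e : Fin (suc n)) →
  insertAt X e true - e ⊆ insertAt X e false
insertAt-true-pivot⊆insertAt-false X e {x} x∈ with pivotView e x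
... | pivot   = ⊥-elim (x∈p─q⇒x∉q (insertAt X e true) ⁅ e ⁆ x∈ (SP.x∈⁅x⁆ e))
... | other j = punchIn∈insertAt⁺ X e j (punchIn∈insertAt⁻ X e j (SP.p─q⊆p _ _ x∈))

insertAt-punchIn⊆insertAt : (X : Subset n) (e : Fin (suc n)) (b : Bool) (j : Fin n) →
  insertAt X e b - punchIn e j ⊆ insertAt (X - j) e b
insertAt-punchIn⊆insertAt X e b j {x} x∈ with pivotView e x
... | pivot   = subst (λ c → e ∈ insertAt (X - j) e c)
                  (trans (sym (VecP.[]=⇒lookup (SP.p─q⊆p _ _ x∈))) (VecP.insertAt-lookup X e b))
                  (VecP.lookup⇒[]= e _ (VecP.insertAt-lookup (X - j) e _))
... | other k = punchIn∈insertAt⁺ (X - j) e k (SP.x∈p∧x≢y⇒x∈p-y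
                  (punchIn∈insertAt⁻ X e k (SP.p─q⊆p _ _ x∈))
                  λ { refl → x∈p─q⇒x∉q (insertAt X e b) ⁅ punchIn e j ⁆ x∈ (SP.x∈⁅x⁆ _) })

module MatroidProperties {N : ℕ} (M : Matroid N) where

  r : Subset N → ℕ
  r = rank M

  Indep : Subset N → Set
  Indep = IndepR r

  Indep? : (X : Subset N) → Dec (Indep X)
  Indep? X = r X ℕP.≟ ∣ X ∣

  indep-stable : {X : Subset N} → ¬ ¬ Indep X → Indep X
  indep-stable {X} ¬¬indep with Indep? X
  ... | yes indep = indep
  ... | no ¬indep = ⊥-elim (¬¬indep ¬indep)

  indep-⊆ : {X Y : Subset N} → Indep Y → X ⊆ Y → Indep X
  indep-⊆ {X} {Y} indepY X⊆Y = ℕP.≤-antisym (rank-bound M X) (ℕP.+-cancelʳ-≤ ∣ D ∣ _ _ ∣X∣+∣D∣≤rX+∣D∣)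
    where
      open ℕP.≤-Reasoning
      D = Y ─ X
      Y⊆X∪D : Y ⊆ X ∪ D
      Y⊆X∪D {x} x∈Y with x SP.∈? X
      ... | yes x∈X = SP.x∈p∪q⁺ (inj₁ x∈X)
      ... | no  x∉X = SP.x∈p∪q⁺ (inj₂ (SP.x∈p∧x∉q⇒x∈p─q x∈Y x∉X))
      ∣X∣+∣D∣≤rX+∣D∣ : ∣ X ∣ ℕ.+ ∣ D ∣ ≤ r X ℕ.+ ∣ D ∣
      ∣X∣+∣D∣≤rX+∣D∣ = begin
        ∣ X ∣ ℕ.+ ∣ D ∣            ≡⟨ p⊆q⇒∣p∣+∣q─p∣≡∣q∣ X Y X⊆Y ⟩
        ∣ Y ∣                      ≡⟨ indepY ⟨
        r Y                        ≤⟨ rank-mono M Y (X ∪ D) Y⊆X∪D ⟩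
        r (X ∪ D)                  ≤⟨ ℕP.m≤m+n _ _ ⟩
        r (X ∪ D) ℕ.+ r (X ∩ D)    ≤⟨ rank-submod M X D ⟩
        r X ℕ.+ r D                ≤⟨ ℕP.+-monoʳ-≤ (r X) (rank-bound M D) ⟩
        r X ℕ.+ ∣ D ∣              ∎

  dep-⊇ : {X Y : Subset N} → ¬ Indep X → X ⊆ Y → ¬ Indep Y
  dep-⊇ ¬indepX X⊆Y indepY = ¬indepX (indep-⊆ indepY X⊆Y)

  ∣X∣≡0⇒indep : {X : Subset N} → ∣ X ∣ ≡ 0 → Indep X
  ∣X∣≡0⇒indep {X} ∣X∣≡0 = trans (ℕP.n≤0⇒n≡0 (subst (r X ≤_) ∣X∣≡0 (rank-bound M X))) (sym ∣X∣≡0)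

  ¬loop⇒rank⁅x⁆≡1 : (x : Fin N) → ¬ Circuit M ⁅ x ⁆ → r ⁅ x ⁆ ≡ 1
  ¬loop⇒rank⁅x⁆≡1 x ¬loop =
    ℕP.≤-antisym r⁅x⁆≤1 (ℕP.n≢0⇒n>0 λ r⁅x⁆≡0 → ¬loop (dependent r⁅x⁆≡0 , properIndep))
    where
      r⁅x⁆≤1 : r ⁅ x ⁆ ≤ 1
      r⁅x⁆≤1 = subst (r ⁅ x ⁆ ≤_) (SP.∣⁅x⁆∣≡1 x) (rank-bound M ⁅ x ⁆)
      dependent : r ⁅ x ⁆ ≡ 0 → ¬ Indep ⁅ x ⁆
      dependent r≡0 indep with trans (sym r≡0) (trans indep (SP.∣⁅x⁆∣≡1 x))
      ... | ()
      properIndep : ∀ Y → Y ⊂ ⁅ x ⁆ → Indep Y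
      properIndep Y Y⊂ = ∣X∣≡0⇒indep (ℕP.n<1⇒n≡0 (subst (∣ Y ∣ <_) (SP.∣⁅x⁆∣≡1 x) (SP.p⊂q⇒∣p∣<∣q∣ Y⊂)))

  circuit-through : (x : Fin N) (D : Subset N) → x ∈ D → ¬ Indep D → Indep (D - x) →
    ∃ λ C → Circuit M C × C ⊆ D × x ∈ C
  circuit-through x D x∈D ¬indepD indepD-x = search (suc ∣ D ∣) D ℕP.≤-refl id x∈D ¬indepD
    where
      -- descend to a minimal dependent subset of D through x; it is a circuit,
      -- since its subsets avoiding x lie in the independent set D - x
      search : (k : ℕ) (S : Subset N) → ∣ S ∣ < k → S ⊆ D → x ∈ S → ¬ Indep S →
               ∃ λ C → Circuit M C × C ⊆ D × x ∈ C
      search (suc k) S ∣S∣<k S⊆D x∈S ¬indepS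
        with SP.anySubset? {P = λ Y → Y ⊂ S × x ∈ Y × ¬ Indep Y}
               (λ Y → (Y SP.⊂? S) ×-dec ((x SP.∈? Y) ×-dec ¬? (Indep? Y)))
      ... | yes (Y , Y⊂S , x∈Y , ¬indepY) =
            search k Y (ℕP.<-≤-trans (SP.p⊂q⇒∣p∣<∣q∣ Y⊂S) (ℕP.≤-pred ∣S∣<k))
                   (S⊆D ∘ SP.p⊂q⇒p⊆q Y⊂S) x∈Y ¬indepY
      ... | no ∄Y = S , (¬indepS , minimal) , S⊆D , x∈S
        where
          minimal : ∀ Y → Y ⊂ S → Indep Y
          minimal Y Y⊂S with x SP.∈? Y
          ... | yes x∈Y = indep-stable λ ¬indepY → ∄Y (Y , Y⊂S , x∈Y , ¬indepY)
          ... | no  x∉Y = indep-⊆ indepD-x λ {y} y∈Y →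
                 SP.x∈p∧x≢y⇒x∈p-y (S⊆D (SP.p⊂q⇒p⊆q Y⊂S y∈Y)) λ { refl → x∉Y y∈Y }

  circuit-rank-remove : {C : Subset N} {x : Fin N} → Circuit M C → x ∈ C → r (C - x) ≡ r C
  circuit-rank-remove {C} {x} (¬indepC , minimal) x∈C =
    ℕP.≤-antisym (rank-mono M _ _ (SP.p─q⊆p C ⁅ x ⁆)) rC≤rC-x
    where
      rC<∣C∣ : r C < ∣ C ∣
      rC<∣C∣ = ℕP.≤∧≢⇒< (rank-bound M C) ¬indepC
      rC≤rC-x : r C ≤ r (C - x)
      rC≤rC-x = subst (r C ≤_) (sym (minimal (C - x) (SP.x∈p⇒p-x⊂p x∈C)))
                  (ℕP.≤-pred (subst (r C <_) (sym (x∈p⇒suc∣p-x∣≡∣p∣ x∈C)) rC<∣C∣))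

  circuit-spans-element : {C S : Subset N} {x : Fin N} → Circuit M C → x ∈ C → C - x ⊆ S →
    r (S ∪ ⁅ x ⁆) ≡ r S
  circuit-spans-element {C} {S} {x} circC x∈C C-x⊆S =
    ℕP.≤-antisym (ℕP.≤-trans (rank-mono M _ _ S∪x⊆S∪C) (ℕP.+-cancelʳ-≤ (r C) _ _ submod))
                 (rank-mono M _ _ (SP.p⊆p∪q ⁅ x ⁆))
    where
      open ℕP.≤-Reasoning
      S∪x⊆S∪C : S ∪ ⁅ x ⁆ ⊆ S ∪ C
      S∪x⊆S∪C y∈ with SP.x∈p∪q⁻ S ⁅ x ⁆ y∈
      ... | inj₁ y∈S = SP.x∈p∪q⁺ (inj₁ y∈S)
      ... | inj₂ y∈x = SP.x∈p∪q⁺ (inj₂ (subst (_∈ C) (sym (SP.x∈⁅y⁆⇒x≡y x y∈x)) x∈C))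
      submod : r (S ∪ C) ℕ.+ r C ≤ r S ℕ.+ r C
      submod = begin
        r (S ∪ C) ℕ.+ r C        ≡⟨ cong (r (S ∪ C) ℕ.+_) (circuit-rank-remove circC x∈C) ⟨
        r (S ∪ C) ℕ.+ r (C - x)  ≤⟨ ℕP.+-monoʳ-≤ (r (S ∪ C)) (rank-mono M _ _ λ y∈ →
                                      SP.x∈p∩q⁺ (C-x⊆S y∈ , SP.p─q⊆p C ⁅ x ⁆ y∈)) ⟩
        r (S ∪ C) ℕ.+ r (S ∩ C)  ≤⟨ rank-submod M S C ⟩
        r S ℕ.+ r C              ∎

module SeriesPair {N : ℕ} (M : Matroid N) {e f : Fin N} (f≢e : f ≢ e)
                  (cocircuit : Cocircuit M (⁅ e ⁆ ∪ ⁅ f ⁆)) where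

  open MatroidProperties M

  private
    P : Subset N
    P = ⁅ e ⁆ ∪ ⁅ f ⁆

    ∁P-not-spanning : r (∁ P) ≢ r ⊤
    ∁P-not-spanning eq = proj₁ cocircuit
      (trans (cong (λ k → (∣ P ∣ ℕ.+ k) ∸ r ⊤) eq) (ℕP.m+n∸n≡m ∣ P ∣ (r ⊤)))

    ⁅f⁆-coindependent : (1 ℕ.+ r (∁ ⁅ f ⁆)) ∸ r ⊤ ≡ 1
    ⁅f⁆-coindependent = subst (λ k → (k ℕ.+ r (∁ ⁅ f ⁆)) ∸ r ⊤ ≡ k) (SP.∣⁅x⁆∣≡1 f)
                          (proj₂ cocircuit ⁅ f ⁆ ⁅f⁆⊂P)
      where
        ⁅f⁆⊂P : ⁅ f ⁆ ⊂ P
        ⁅f⁆⊂P = SP.q⊆p∪q ⁅ e ⁆ ⁅ f ⁆ , e , SP.p⊆p∪q ⁅ f ⁆ (SP.x∈⁅x⁆ e) , SP.x≢y⇒x∉⁅y⁆ (f≢e ∘ sym)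

    ∁⁅f⁆-spanning : r (∁ ⁅ f ⁆) ≡ r ⊤
    ∁⁅f⁆-spanning with ℕP.m≤n⇒m<n∨m≡n (rank-mono M _ _ (SP.⊆⊤ {p = ∁ ⁅ f ⁆}))
    ... | inj₂ eq = eq
    ... | inj₁ lt with trans (sym (ℕP.m≤n⇒m∸n≡0 lt)) ⁅f⁆-coindependent
    ...   | ()

  -- otherwise e lies in the closure of E - {e, f}, which then spans E - f and hence E
  circuit-∋e⇒∋f : ∀ {C} → Circuit M C → e ∈ C → f ∈ C
  circuit-∋e⇒∋f {C} circC e∈C with f SP.∈? C
  ... | yes f∈C = f∈C
  ... | no  f∉C = ⊥-elim (∁P-not-spanning (ℕP.≤-antisym (rank-mono M _ _ SP.⊆⊤) r⊤≤r∁P))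
    where
      outsideP : ∀ {z} → z ≢ e → z ≢ f → z ∈ ∁ P
      outsideP z≢e z≢f = SP.x∉p⇒x∈∁p λ z∈P →
        [ z≢e ∘ SP.x∈⁅y⁆⇒x≡y e , z≢f ∘ SP.x∈⁅y⁆⇒x≡y f ]′ (SP.x∈p∪q⁻ ⁅ e ⁆ ⁅ f ⁆ z∈P)
      C-e⊆∁P : C - e ⊆ ∁ P
      C-e⊆∁P z∈ = outsideP (λ { refl → x∈p─q⇒x∉q C ⁅ e ⁆ z∈ (SP.x∈⁅x⁆ e) })
                           (λ { refl → f∉C (SP.p─q⊆p C ⁅ e ⁆ z∈) })
      ∁⁅f⁆⊆∁P∪e : ∁ ⁅ f ⁆ ⊆ ∁ P ∪ ⁅ e ⁆
      ∁⁅f⁆⊆∁P∪e {z} z∈ with z FinP.≟ e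
      ... | yes refl = SP.q⊆p∪q (∁ P) ⁅ e ⁆ (SP.x∈⁅x⁆ e)
      ... | no  z≢e  = SP.p⊆p∪q ⁅ e ⁆ (outsideP z≢e λ { refl → SP.x∈∁p⇒x∉p z∈ (SP.x∈⁅x⁆ f) })
      r⊤≤r∁P : r ⊤ ≤ r (∁ P)
      r⊤≤r∁P = subst₂ _≤_ ∁⁅f⁆-spanning (circuit-spans-element circC e∈C C-e⊆∁P)
                 (rank-mono M _ _ ∁⁅f⁆⊆∁P∪e)

-- Circuits of single-element deletions and contractions

module Deletion {n : ℕ} (M : Matroid (suc n)) (M₁ : Matroid n) (e : Fin (suc n))
                (deletion : IsDeletion M e M₁) where

  open MatroidProperties M

  indep⁺ : ∀ X → IndepR (rank M₁) X → Indep (insertAt X e false)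
  indep⁺ X indep = trans (sym (deletion X)) (trans indep (sym (∣insertAt∣ X e false)))

  indep⁻ : ∀ X → Indep (insertAt X e false) → IndepR (rank M₁) X
  indep⁻ X indep = trans (deletion X) (trans indep (∣insertAt∣ X e false))

  circuit⁺ : ∀ C → Circuit M₁ C → Circuit M (insertAt C e false)
  circuit⁺ C (¬indep , minimal) = ¬indep ∘ indep⁻ C , λ Z Z⊂ →
    let Ze≡false = ⊆insertAt-false⇒lookup≡false e (SP.p⊂q⇒p⊆q Z⊂) in
    subst Indep (sym (insertAt-removeAt-lookup Z e Ze≡false))
          (indep⁺ _ (minimal _ (removeAt-⊂ e Z⊂ Ze≡false)))

  circuit⁻ : ∀ C → Circuit M C → lookup C e ≡ false → Circuit M₁ (removeAt C e)
  circuit⁻ C (¬indep , minimal) Ce≡false =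
    (λ indep → ¬indep (subst Indep C≡ (indep⁺ _ indep))) ,
    λ Y Y⊂ → indep⁻ Y (minimal _ (subst (insertAt Y e false ⊂_) C≡ (insertAt-⊂ e Y⊂ b≤b)))
    where
      C≡ : insertAt (removeAt C e) e false ≡ C
      C≡ = sym (insertAt-removeAt-lookup C e Ce≡false)

module Contraction {n : ℕ} (M : Matroid (suc n)) (M₁ : Matroid n) (e : Fin (suc n))
                   (contraction : IsContraction M e M₁) (¬loop : ¬ Circuit M ⁅ e ⁆) where

  open MatroidProperties M

  private
    r⁅e⁆≡1 : r ⁅ e ⁆ ≡ 1
    r⁅e⁆≡1 = ¬loop⇒rank⁅x⁆≡1 e ¬loop

    1≤r : ∀ X → 1 ≤ r (insertAt X e true)
    1≤r X = subst (_≤ r (insertAt X e true)) r⁅e⁆≡1 (rank-mono M _ _ (⁅pivot⁆⊆insertAt X e))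

  indep⁺ : ∀ X → IndepR (rank M₁) X → Indep (insertAt X e true)
  indep⁺ X indep = begin
    r (insertAt X e true)           ≡⟨ ℕP.m∸n+n≡m (1≤r X) ⟨
    r (insertAt X e true) ∸ 1 ℕ.+ 1 ≡⟨ ℕP.+-comm _ 1 ⟩
    suc (r (insertAt X e true) ∸ 1) ≡⟨ cong (λ k → suc (r (insertAt X e true) ∸ k)) r⁅e⁆≡1 ⟨
    suc (r (insertAt X e true) ∸ r ⁅ e ⁆) ≡⟨ cong suc (trans (sym (contraction X)) indep) ⟩
    suc ∣ X ∣                       ≡⟨ ∣insertAt∣ X e true ⟨
    ∣ insertAt X e true ∣           ∎
    where open ≡-Reasoning

  indep⁻ : ∀ X → Indep (insertAt X e true) → IndepR (rank M₁) X
  indep⁻ X indep = trans (contraction X)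
    (trans (cong (r (insertAt X e true) ∸_) r⁅e⁆≡1) (cong (_∸ 1) (trans indep (∣insertAt∣ X e true))))

  circuit⁺ : ∀ C → Circuit M₁ C →
    ¬ Indep (insertAt C e true) × (∀ Y → Y ⊂ C → Indep (insertAt Y e true))
  circuit⁺ C (¬indep , minimal) = ¬indep ∘ indep⁻ C , λ Y Y⊂ → indep⁺ Y (minimal Y Y⊂)

  circuit⁻ : ∀ C → ¬ Indep (insertAt C e true) → (∀ Y → Y ⊂ C → Indep (insertAt Y e true)) →
    Circuit M₁ C
  circuit⁻ C ¬indep minimal = ¬indep ∘ indep⁺ C , λ Y Y⊂ → indep⁻ Y (minimal Y Y⊂)

  circuit-through-pivot : ∀ X → Indep (insertAt X e false) → ¬ Indep (insertAt X e true) →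
    ∃ λ D → Circuit M D × D ⊆ insertAt X e true × e ∈ D
  circuit-through-pivot X indep ¬indep = circuit-through e (insertAt X e true) (pivot∈insertAt X e)
    ¬indep (indep-⊆ indep (insertAt-true-pivot⊆insertAt-false X e))

  circuit⁺-pivot∉ : ∀ C → Circuit M₁ C → (∀ D → Circuit M D → D ⊆ insertAt C e true → e ∉ D) →
    Circuit M (insertAt C e false)
  circuit⁺-pivot∉ C circC no-circuit-through-e = ¬indep , minimal′
    where
      minimal = proj₂ (circuit⁺ C circC)
      ¬indep : ¬ Indep (insertAt C e false)
      ¬indep indep with circuit-through-pivot C indep (proj₁ (circuit⁺ C circC))
      ... | D , circD , D⊆ , e∈D = no-circuit-through-e D circD D⊆ e∈D
      minimal′ : ∀ Z → Z ⊂ insertAt C e false → Indep Z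
      minimal′ Z Z⊂ = indep-⊆ (minimal _ (removeAt-⊂ e Z⊂ Ze≡false))
        (subst (_⊆ insertAt (removeAt Z e) e true) (sym (insertAt-removeAt-lookup Z e Ze≡false))
               (insertAt-⊆ e id f≤t))
        where Ze≡false = ⊆insertAt-false⇒lookup≡false e (SP.p⊂q⇒p⊆q Z⊂)

  circuit⁺-pivot∈ : ∀ C → Circuit M₁ C → Indep (insertAt C e false) → Circuit M (insertAt C e true)
  circuit⁺-pivot∈ C circC indep = proj₁ (circuit⁺ C circC) , minimal′
    where
      minimal′ : ∀ Z → Z ⊂ insertAt C e true → Indep Z
      minimal′ Z Z⊂ with lookup Z e in Ze
      ... | true  = subst Indep (sym (insertAt-removeAt-lookup Z e Ze))
                      (proj₂ (circuit⁺ C circC) _ (removeAt-⊂ e Z⊂ Ze))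
      ... | false = indep-⊆ indep (subst (_⊆ insertAt C e false) (sym (insertAt-removeAt-lookup Z e Ze))
                      (insertAt-⊆ e (removeAt-⊆ e (SP.p⊂q⇒p⊆q Z⊂)) b≤b))

  circuit⁻-pivot∈ : ∀ C → Circuit M C → lookup C e ≡ true → Circuit M₁ (removeAt C e)
  circuit⁻-pivot∈ C (¬indep , minimal) Ce≡true =
    circuit⁻ _ (subst (¬_ ∘ Indep) C≡ ¬indep)
               (λ Y Y⊂ → minimal _ (subst (insertAt Y e true ⊂_) (sym C≡) (insertAt-⊂ e Y⊂ b≤b)))
    where
      C≡ : C ≡ insertAt (removeAt C e) e true
      C≡ = insertAt-removeAt-lookup C e Ce≡true

  circuit⁻-pivot∉ : ∀ C → Circuit M C → lookup C e ≡ false →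
    (∀ D → Circuit M D → D ⊆ insertAt (removeAt C e) e true → e ∉ D) → Circuit M₁ (removeAt C e)
  circuit⁻-pivot∉ C (¬indep , minimal) Ce≡false no-circuit-through-e = circuit⁻ _ ¬indep⁺ minimal⁺
    where
      C≡ : C ≡ insertAt (removeAt C e) e false
      C≡ = insertAt-removeAt-lookup C e Ce≡false
      ¬indep⁺ : ¬ Indep (insertAt (removeAt C e) e true)
      ¬indep⁺ = dep-⊇ (subst (¬_ ∘ Indep) C≡ ¬indep) (insertAt-⊆ e id f≤t)
      minimal⁺ : ∀ Y → Y ⊂ removeAt C e → Indep (insertAt Y e true)
      minimal⁺ Y Y⊂ = indep-stable λ ¬indepY →
        let D , circD , D⊆ , e∈D = circuit-through-pivot Y indepY ¬indepY
        in no-circuit-through-e D circD (SP.⊆-trans D⊆ (insertAt-⊆ e (SP.p⊂q⇒p⊆q Y⊂) b≤b)) e∈D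
        where indepY = minimal _ (subst (insertAt Y e false ⊂_) (sym C≡) (insertAt-⊂ e Y⊂ b≤b))

module ColoopContraction {n : ℕ} (M : Matroid (suc n)) (M₁ : Matroid n) (e : Fin (suc n))
                         (coloop : Coloop M e) (contraction : IsContraction M e M₁) where

  open Contraction M M₁ e contraction (λ loop → coloop ⁅ e ⁆ loop (SP.x∈⁅x⁆ e))

  circuit-pivot∉ : ∀ C → Circuit M C → lookup C e ≡ false
  circuit-pivot∉ C circC with lookup C e in Ce
  ... | false = refl
  ... | true  = ⊥-elim (coloop C circC (VecP.lookup⇒[]= e C Ce))

  lift-circuit : ∀ C → Circuit M₁ C → Circuit M (insertAt C e false)
  lift-circuit C circC = circuit⁺-pivot∉ C circC λ D circD _ → coloop D circD

  restrict-circuit : ∀ C → Circuit M C → Circuit M₁ (removeAt C e)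
  restrict-circuit C circC =
    circuit⁻-pivot∉ C circC (circuit-pivot∉ C circC) λ D circD _ → coloop D circD

module SeriesContraction {n : ℕ} (M : Matroid (suc n)) (M₁ : Matroid n) (e : Fin (suc n)) {f : Fin (suc n)}
                         (f≢e : f ≢ e) (cocircuit : Cocircuit M (⁅ e ⁆ ∪ ⁅ f ⁆))
                         (contraction : IsContraction M e M₁) where

  open MatroidProperties M
  open SeriesPair M f≢e cocircuit using (circuit-∋e⇒∋f)
  open SeriesPair M (f≢e ∘ sym) (subst (Cocircuit M) (SP.∪-comm ⁅ e ⁆ ⁅ f ⁆) cocircuit)
    renaming (circuit-∋e⇒∋f to circuit-∋f⇒∋e)
  open Contraction M M₁ e contraction (λ loop → f≢e (SP.x∈⁅y⁆⇒x≡y e (circuit-∋e⇒∋f loop (SP.x∈⁅x⁆ e))))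

  f₁ : Fin n
  f₁ = punchOut (f≢e ∘ sym)

  private
    punchIn-f₁ : punchIn e f₁ ≡ f
    punchIn-f₁ = FinP.punchIn-punchOut (f≢e ∘ sym)

    f∈⁺ : ∀ X {b} → f₁ ∈ X → f ∈ insertAt X e b
    f∈⁺ X f₁∈ = subst (_∈ insertAt X e _) punchIn-f₁ (punchIn∈insertAt⁺ X e f₁ f₁∈)

    f∈⁻ : ∀ X {b} → f ∈ insertAt X e b → f₁ ∈ X
    f∈⁻ X f∈ = punchIn∈insertAt⁻ X e f₁ (subst (_∈ insertAt X e _) (sym punchIn-f₁) f∈)

    circuit-through-e⇒f₁∈ : ∀ X D → Circuit M D → D ⊆ insertAt X e true → e ∈ D → f₁ ∈ X
    circuit-through-e⇒f₁∈ X D circD D⊆ e∈D = f∈⁻ X (D⊆ (circuit-∋e⇒∋f circD e∈D))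

  lift-circuit : ∀ C → Circuit M₁ C → Circuit M (insertAt C e (lookup C f₁))
  lift-circuit C circC with lookup C f₁ in Cf₁
  ... | false = circuit⁺-pivot∉ C circC λ D circD D⊆ e∈D →
      f₁∉C (circuit-through-e⇒f₁∈ C D circD D⊆ e∈D)
    where
      f₁∉C : f₁ ∉ C
      f₁∉C f₁∈ with trans (sym (VecP.[]=⇒lookup f₁∈)) Cf₁
      ... | ()
  -- a circuit inside C would pass through f, as C - f is independent, and hence through e ∉ C
  ... | true = circuit⁺-pivot∈ C circC (indep-stable λ ¬indep →
      let D , circD , D⊆ , f∈D = circuit-through f (insertAt C e false) (f∈⁺ C f₁∈C) ¬indep
                                   (indep-⊆ indepC-f₁ C-f⊆)
      in pivot∉insertAt C e (D⊆ (circuit-∋f⇒∋e circD f∈D)))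
    where
      f₁∈C = VecP.lookup⇒[]= f₁ C Cf₁
      indepC-f₁ : Indep (insertAt (C - f₁) e false)
      indepC-f₁ = indep-⊆ (proj₂ (circuit⁺ C circC) (C - f₁) (SP.x∈p⇒p-x⊂p f₁∈C)) (insertAt-⊆ e id f≤t)
      C-f⊆ : insertAt C e false - f ⊆ insertAt (C - f₁) e false
      C-f⊆ = subst (λ x → insertAt C e false - x ⊆ insertAt (C - f₁) e false) punchIn-f₁
               (insertAt-punchIn⊆insertAt C e false f₁)

  restrict-circuit : ∀ C → Circuit M C → Circuit M₁ (removeAt C e)
  restrict-circuit C circC with lookup C e in Ce
  ... | true  = circuit⁻-pivot∈ C circC Ce
  ... | false = circuit⁻-pivot∉ C circC Ce λ D circD D⊆ e∈D →
      f∉C (subst (f ∈_) (sym (insertAt-removeAt-lookup C e Ce))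
                 (f∈⁺ (removeAt C e) (circuit-through-e⇒f₁∈ (removeAt C e) D circD D⊆ e∈D)))
    where
      f∉C : f ∉ C
      f∉C f∈C with trans (sym (VecP.[]=⇒lookup (circuit-∋f⇒∋e circC f∈C))) Ce
      ... | ()

module FormalSums {c ℓ} (K : Field c ℓ) (A : MonAlg) where

  open Field K using (Carrier; _≈_; _+_; 0#; +-cong; +-assoc; +-comm; +-identityˡ; setoid)
    renaming (refl to ≈-refl; sym to ≈-sym; trans to ≈-trans)
  open Poly K A

  coeffSum : (Mon → Bool) → Elt → Carrier
  coeffSum Q []             = 0#
  coeffSum Q ((a , gs) ∷ p) = if Q (mon gs) then a + coeffSum Q p else coeffSum Q p

  dropMon : Mon → Elt → Elt
  dropMon m [] = []
  dropMon m ((a , gs) ∷ p) with mon gs ≟M m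
  ... | yes _ = dropMon m p
  ... | no  _ = (a , gs) ∷ dropMon m p

  private
    select : Bool → Carrier → Carrier
    select b x = if b then x else 0#

    select-0 : ∀ b → select b 0# ≈ 0#
    select-0 true  = ≈-refl
    select-0 false = ≈-refl

    select-cong : ∀ b {x y} → x ≈ y → select b x ≈ select b y
    select-cong true  x≈y = x≈y
    select-cong false _   = ≈-refl

    +-exchange : ∀ a x s → a + (x + s) ≈ x + (a + s)
    +-exchange a x s = begin
      a + (x + s) ≈⟨ +-assoc a x s ⟨
      (a + x) + s ≈⟨ +-cong (+-comm a x) ≈-refl ⟩
      (x + a) + s ≈⟨ +-assoc x a s ⟩
      x + (a + s) ∎
      where open import Relation.Binary.Reasoning.Setoid setoid

  coeffSum-dropMon : ∀ Q m p → coeffSum Q p ≈ select (Q m) (coeff p m) + coeffSum Q (dropMon m p)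
  coeffSum-dropMon Q m [] = ≈-sym (≈-trans (+-cong (select-0 (Q m)) ≈-refl) (+-identityˡ 0#))
  coeffSum-dropMon Q m ((a , gs) ∷ p) with mon gs ≟M m
  ... | yes refl with Q (mon gs) | coeffSum-dropMon Q (mon gs) p
  ...   | true  | ih = ≈-trans (+-cong ≈-refl ih) (≈-sym (+-assoc a _ _))
  ...   | false | ih = ih
  coeffSum-dropMon Q m ((a , gs) ∷ p) | no _ with Q (mon gs) | coeffSum-dropMon Q m p
  ...   | true  | ih = ≈-trans (+-cong ≈-refl ih) (+-exchange a _ _)
  ...   | false | ih = ih

  coeff-dropMon-≡ : ∀ m p → coeff (dropMon m p) m ≈ 0#
  coeff-dropMon-≡ m [] = ≈-refl
  coeff-dropMon-≡ m ((a , gs) ∷ p) with mon gs ≟M m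
  ... | yes _ = coeff-dropMon-≡ m p
  ... | no gs≢m with mon gs ≟M m
  ...   | yes gs≡m = ⊥-elim (gs≢m gs≡m)
  ...   | no  _    = coeff-dropMon-≡ m p

  coeff-dropMon-≢ : ∀ m m′ p → m′ ≢ m → coeff (dropMon m p) m′ ≈ coeff p m′
  coeff-dropMon-≢ m m′ [] _ = ≈-refl
  coeff-dropMon-≢ m m′ ((a , gs) ∷ p) m′≢m with mon gs ≟M m
  ... | yes gs≡m with mon gs ≟M m′
  ...   | yes gs≡m′ = ⊥-elim (m′≢m (trans (sym gs≡m′) gs≡m))
  ...   | no  _     = coeff-dropMon-≢ m m′ p m′≢m
  coeff-dropMon-≢ m m′ ((a , gs) ∷ p) m′≢m | no _ with mon gs ≟M m′
  ...   | yes _ = +-cong ≈-refl (coeff-dropMon-≢ m m′ p m′≢m)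
  ...   | no  _ = coeff-dropMon-≢ m m′ p m′≢m

  dropMon-cong : ∀ m {p q} → p ≈E q → dropMon m p ≈E dropMon m q
  dropMon-cong m {p} {q} p≈q m′ with m′ ≟M m
  ... | yes refl = ≈-trans (coeff-dropMon-≡ m p) (≈-sym (coeff-dropMon-≡ m q))
  ... | no m′≢m  = ≈-trans (coeff-dropMon-≢ m m′ p m′≢m)
                     (≈-trans (p≈q m′) (≈-sym (coeff-dropMon-≢ m m′ q m′≢m)))

  length-dropMon : ∀ m p → length (dropMon m p) ≤ length p
  length-dropMon m [] = z≤n
  length-dropMon m ((a , gs) ∷ p) with mon gs ≟M m
  ... | yes _ = ℕP.m≤n⇒m≤1+n (length-dropMon m p)
  ... | no  _ = s≤s (length-dropMon m p)

  length-dropMon-head : ∀ a gs p → length (dropMon (mon gs) ((a , gs) ∷ p)) ≤ length p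
  length-dropMon-head a gs p with mon gs ≟M mon gs
  ... | yes _   = length-dropMon (mon gs) p
  ... | no  ≢gs = ⊥-elim (≢gs refl)

  -- Peel off, in both sums, all terms of the monomial heading either list.
  coeffSum-cong : ∀ Q p q → p ≈E q → coeffSum Q p ≈ coeffSum Q q
  coeffSum-cong Q p q = bounded (length p ℕ.+ length q) p q ℕP.≤-refl
    where
      peel : ∀ m p q → p ≈E q → coeffSum Q (dropMon m p) ≈ coeffSum Q (dropMon m q) →
             coeffSum Q p ≈ coeffSum Q q
      peel m p q p≈q ih = ≈-trans (coeffSum-dropMon Q m p)
        (≈-trans (+-cong (select-cong (Q m) (p≈q m)) ih) (≈-sym (coeffSum-dropMon Q m q)))
      bounded : ∀ k p q → length p ℕ.+ length q ≤ k → p ≈E q → coeffSum Q p ≈ coeffSum Q q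
      bounded k       []             []             _ _   = ≈-refl
      bounded (suc k) p@((a , gs) ∷ p′) q (s≤s len) p≈q = peel (mon gs) p q p≈q
        (bounded k (dropMon (mon gs) p) (dropMon (mon gs) q)
          (ℕP.≤-trans (ℕP.+-mono-≤ (length-dropMon-head a gs p′) (length-dropMon (mon gs) q)) len)
          (dropMon-cong (mon gs) {p} {q} p≈q))
      bounded (suc k) [] q@((b , hs) ∷ q′) (s≤s len) p≈q = peel (mon hs) [] q p≈q
        (bounded k [] (dropMon (mon hs) q) (ℕP.≤-trans (length-dropMon-head b hs q′) len)
          (dropMon-cong (mon hs) {[]} {q} p≈q))

-- Homomorphisms induced by maps of generators

traverseMaybe : {X Y : Set} → (X → Maybe Y) → List X → Maybe (List Y)
traverseMaybe σ []       = just []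
traverseMaybe σ (x ∷ xs) = Maybe.zipWith _∷_ (σ x) (traverseMaybe σ xs)

traverseMaybe-++ : {X Y : Set} (σ : X → Maybe Y) (xs ys : List X) →
  traverseMaybe σ (xs ++ ys) ≡ Maybe.zipWith _++_ (traverseMaybe σ xs) (traverseMaybe σ ys)
traverseMaybe-++ σ [] ys with traverseMaybe σ ys
... | just _  = refl
... | nothing = refl
traverseMaybe-++ σ (x ∷ xs) ys rewrite traverseMaybe-++ σ xs ys
  with σ x | traverseMaybe σ xs | traverseMaybe σ ys
... | nothing | _       | _       = refl
... | just _  | nothing | _       = refl
... | just _  | just _  | nothing = refl
... | just _  | just _  | just _  = refl

traverseMaybe-length : {X Y : Set} (σ : X → Maybe Y) (xs : List X) {ys : List Y} →
  traverseMaybe σ xs ≡ just ys → length ys ≡ length xs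
traverseMaybe-length σ [] refl = refl
traverseMaybe-length σ (x ∷ xs) eq with σ x | traverseMaybe σ xs in eqs
traverseMaybe-length σ (x ∷ xs) refl | just _ | just _ = cong suc (traverseMaybe-length σ xs eqs)

data ImageSpec {A B : MonAlg} (F : Vec ℕ (vars A) → Vec ℕ (vars B)) (κ : Vec ℕ (vars A) → ℕ)
               (v : Vec ℕ (vars A)) : Maybe (Gen B) → Set where
  killed : κ v ≢ 0 → ImageSpec F κ v nothing
  sent   : ∀ {h} → κ v ≡ 0 → wt B h ≡ F v → ImageSpec F κ v (just h)

-- The restriction to K[A] of the substitution y ↦ y^exponents of K[y, z] that also sets the
-- variables counted by `vanishing` to 0: each generator goes to a generator of B or to 0.
record GeneratorMap (A B : MonAlg) : Set where
  field
    exponents   : Vec ℕ (vars A) → Vec ℕ (vars B)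
    exponents-+ : ∀ u v → exponents (zipWith ℕ._+_ u v) ≡ zipWith ℕ._+_ (exponents u) (exponents v)
    exponents-0 : exponents (replicate _ 0) ≡ replicate _ 0
    vanishing   : Vec ℕ (vars A) → ℕ
    vanishing-+ : ∀ u v → vanishing (zipWith ℕ._+_ u v) ≡ vanishing u ℕ.+ vanishing v
    vanishing-0 : vanishing (replicate _ 0) ≡ 0
    image       : Gen A → Maybe (Gen B)
    image-spec  : ∀ g → ImageSpec {A} {B} exponents vanishing (wt A g) (image g)

module Induced {c ℓ} (K : Field c ℓ) {A B : MonAlg} (φ : GeneratorMap A B) where

  open GeneratorMap φ
  open Field K using (Carrier; _≈_; _+_; _*_; +-cong)
    renaming (refl to ≈-refl; sym to ≈-sym; trans to ≈-trans)
  private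
    module PA = Poly K A
    module PB = Poly K B

  image* : List (Gen A) → Maybe (List (Gen B))
  image* = traverseMaybe image

  data MonSpec (m : PA.Mon) : Maybe (List (Gen B)) → Set where
    killed : vanishing (proj₁ m) ≢ 0 → MonSpec m nothing
    sent   : ∀ {hs} → vanishing (proj₁ m) ≡ 0 → PB.mon hs ≡ (exponents (proj₁ m) , proj₂ m) →
             MonSpec m (just hs)

  image*-spec : ∀ gs → MonSpec (PA.mon gs) (image* gs)
  image*-spec [] = sent vanishing-0 (cong (_, 0) (sym exponents-0))
  image*-spec (g ∷ gs) with image g | image-spec g | image* gs | image*-spec gs
  ... | nothing | killed κg≢0 | _ | _ =
    killed λ κ≡0 → κg≢0 (ℕP.m+n≡0⇒m≡0 _ (trans (sym (vanishing-+ (wt A g) _)) κ≡0))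
  ... | just h | sent _ _ | nothing | killed κgs≢0 =
    killed λ κ≡0 → κgs≢0 (ℕP.m+n≡0⇒n≡0 (vanishing (wt A g)) (trans (sym (vanishing-+ (wt A g) _)) κ≡0))
  ... | just h | sent κg≡0 wt≡ | just hs | sent κgs≡0 mon≡ =
    sent (trans (vanishing-+ (wt A g) _) (cong₂ ℕ._+_ κg≡0 κgs≡0))
         (trans (cong₂ (λ u m → zipWith ℕ._+_ u (proj₁ m) , suc (proj₂ m)) wt≡ mon≡)
                (cong (_, _) (sym (exponents-+ (wt A g) _))))

  monImage : PA.Mon → Maybe PB.Mon
  monImage (v , k) with vanishing v ℕP.≟ 0
  ... | yes _ = just (exponents v , k)
  ... | no  _ = nothing

  MonSpec⇒monImage : ∀ {m mh} → MonSpec m mh → Maybe.map PB.mon mh ≡ monImage m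
  MonSpec⇒monImage {v , k} (killed κ≢0) with vanishing v ℕP.≟ 0
  ... | yes κ≡0 = ⊥-elim (κ≢0 κ≡0)
  ... | no  _   = refl
  MonSpec⇒monImage {v , k} (sent κ≡0 mon≡) with vanishing v ℕP.≟ 0
  ... | yes _   = cong just mon≡
  ... | no  κ≢0 = ⊥-elim (κ≢0 κ≡0)

  termImage : Carrier → Maybe (List (Gen B)) → PB.Elt
  termImage a nothing   = []
  termImage a (just hs) = (a , hs) ∷ []

  hom : PA.Elt → PB.Elt
  hom []             = []
  hom ((a , gs) ∷ p) = termImage a (image* gs) ++ hom p

  private
    hits : PB.Mon → Maybe PB.Mon → Bool
    hits m′ mm = does (MaybeP.≡-dec PB._≟M_ mm (just m′))

    coeff-termImage : ∀ a mh rest m′ → PB.coeff (termImage a mh ++ rest) m′ ≈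
      (if hits m′ (Maybe.map PB.mon mh) then a + PB.coeff rest m′ else PB.coeff rest m′)
    coeff-termImage a nothing   rest m′ = ≈-refl
    coeff-termImage a (just hs) rest m′ with PB.mon hs PB.≟M m′
    ... | yes _ = ≈-refl
    ... | no  _ = ≈-refl

  open FormalSums K A using (coeffSum; coeffSum-cong)

  coeff-hom : ∀ p m′ → PB.coeff (hom p) m′ ≈ coeffSum (hits m′ ∘ monImage) p
  coeff-hom []             m′ = ≈-refl
  coeff-hom ((a , gs) ∷ p) m′ rewrite sym (MonSpec⇒monImage (image*-spec gs))
    with coeff-termImage a (image* gs) (hom p) m′
  ... | eq with hits m′ (Maybe.map PB.mon (image* gs))
  ...   | true  = ≈-trans eq (+-cong ≈-refl (coeff-hom p m′))
  ...   | false = ≈-trans eq (coeff-hom p m′)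

  hom-cong : ∀ p q → p PA.≈E q → hom p PB.≈E hom q
  hom-cong p q p≈q m′ =
    ≈-trans (coeff-hom p m′) (≈-trans (coeffSum-cong (hits m′ ∘ monImage) p q p≈q) (≈-sym (coeff-hom q m′)))

  hom-++ : ∀ p q → hom (p ++ q) ≡ hom p ++ hom q
  hom-++ []             q = refl
  hom-++ ((a , gs) ∷ p) q =
    trans (cong (termImage a (image* gs) ++_) (hom-++ p q))
          (sym (ListP.++-assoc (termImage a (image* gs)) _ _))

  private
    mulTerm : {X : Set} → Carrier × List X → Carrier × List X → Carrier × List X
    mulTerm (a , xs) (b , ys) = a * b , xs ++ ys

    *E-distribʳ-++ : ∀ xs ys zs → (xs ++ ys) PB.*E zs ≡ (xs PB.*E zs) ++ (ys PB.*E zs)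
    *E-distribʳ-++ xs ys zs =
      trans (cong List.concat (ListP.map-++ _ xs ys)) (sym (ListP.concat-++ (List.map _ xs) _))

    row-killed : ∀ a gs q → image* gs ≡ nothing → hom (List.map (mulTerm (a , gs)) q) ≡ []
    row-killed a gs []             _  = refl
    row-killed a gs ((b , hs) ∷ q) gs↦ rewrite traverseMaybe-++ image gs hs | gs↦ = row-killed a gs q gs↦

    row-sent : ∀ a gs hs q → image* gs ≡ just hs →
      hom (List.map (mulTerm (a , gs)) q) ≡ List.map (mulTerm (a , hs)) (hom q)
    row-sent a gs hs []              _ = refl
    row-sent a gs hs ((b , gs′) ∷ q) gs↦ rewrite traverseMaybe-++ image gs gs′ | gs↦ with image* gs′
    ... | nothing  = row-sent a gs hs q gs↦
    ... | just hs′ = cong ((a * b , hs ++ hs′) ∷_) (row-sent a gs hs q gs↦)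

    row : ∀ a gs q → hom (List.map (mulTerm (a , gs)) q) ≡ termImage a (image* gs) PB.*E hom q
    row a gs q with image* gs in gs↦
    ... | nothing = row-killed a gs q gs↦
    ... | just hs = trans (row-sent a gs hs q gs↦) (sym (ListP.++-identityʳ _))

  hom-* : ∀ p q → hom (p PA.*E q) ≡ hom p PB.*E hom q
  hom-* []             q = refl
  hom-* ((a , gs) ∷ p) q = begin
    hom (List.map (mulTerm (a , gs)) q ++ p PA.*E q)
      ≡⟨ hom-++ (List.map (mulTerm (a , gs)) q) (p PA.*E q) ⟩
    hom (List.map (mulTerm (a , gs)) q) ++ hom (p PA.*E q)
      ≡⟨ cong₂ _++_ (row a gs q) (hom-* p q) ⟩
    (termImage a (image* gs) PB.*E hom q) ++ (hom p PB.*E hom q)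
      ≡⟨ *E-distribʳ-++ (termImage a (image* gs)) (hom p) (hom q) ⟨
    (termImage a (image* gs) ++ hom p) PB.*E hom q ∎
    where open ≡-Reasoning

  hom-· : ∀ a p → hom (a PA.·E p) ≡ a PB.·E hom p
  hom-· a []             = refl
  hom-· a ((b , gs) ∷ p) with image* gs
  ... | nothing = hom-· a p
  ... | just hs = cong ((a * b , hs) ∷_) (hom-· a p)

  hom-degree : ∀ i p → All (λ t → length (proj₂ t) ≡ i) p → All (λ t → length (proj₂ t) ≡ i) (hom p)
  hom-degree i []             []           = []
  hom-degree i ((a , gs) ∷ p) (len≡i ∷ ls) with image* gs in gs↦
  ... | nothing = hom-degree i p ls
  ... | just hs = trans (traverseMaybe-length image gs gs↦) len≡i ∷ hom-degree i p ls

  isHomHom : IsHomHom K A B hom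
  isHomHom = record
    { cong  = hom-cong
    ; hom-+ = λ p q → ≡⇒≈E (hom-++ p q)
    ; hom-* = λ p q → ≡⇒≈E (hom-* p q)
    ; hom-1 = λ _ → ≈-refl
    ; hom-· = λ a p → ≡⇒≈E (hom-· a p)
    ; homog = 1 , λ i p → λ (q , q≈p , homogQ) →
        subst (λ j → PB.Homog j (hom p)) (sym (ℕP.*-identityˡ i))
              (hom q , hom-cong q p q≈p , hom-degree i q homogQ)
    }
    where
      ≡⇒≈E : ∀ {p q} → p ≡ q → p PB.≈E q
      ≡⇒≈E refl _ = ≈-refl

  hom-∷ : ∀ a gs {hs} p → image* gs ≡ just hs → hom ((a , gs) ∷ p) ≡ (a , hs) ∷ hom p
  hom-∷ a gs p gs↦ rewrite gs↦ = refl

traverseMaybe-section : {X Y V : Set} (σ : X → Maybe Y) (τ : Y → Maybe X) (w : X → V) →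
  (∀ x → ∃ λ y → σ x ≡ just y × ∃ λ x′ → τ y ≡ just x′ × w x′ ≡ w x) →
  ∀ xs → ∃ λ ys → traverseMaybe σ xs ≡ just ys ×
         ∃ λ xs′ → traverseMaybe τ ys ≡ just xs′ × List.map w xs′ ≡ List.map w xs
traverseMaybe-section σ τ w section []       = [] , refl , [] , refl , refl
traverseMaybe-section σ τ w section (x ∷ xs)
  with section x | traverseMaybe-section σ τ w section xs
... | y , σx , x′ , τy , wx | ys , σxs , xs′ , τys , wxs =
  y ∷ ys , cong₂ (Maybe.zipWith _∷_) σx σxs ,
  x′ ∷ xs′ , cong₂ (Maybe.zipWith _∷_) τy τys , cong₂ _∷_ wx wxs

module _ {c ℓ} (K : Field c ℓ) where

  open Field K using (_≈_; _+_) renaming (refl to ≈-refl; trans to ≈-trans)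

  mon-wt : (A : MonAlg) (gs hs : List (Gen A)) →
    List.map (wt A) gs ≡ List.map (wt A) hs → Poly.mon K A gs ≡ Poly.mon K A hs
  mon-wt A []       []       _  = refl
  mon-wt A (g ∷ gs) (h ∷ hs) eq = cong₂ (λ u m → zipWith ℕ._+_ u (proj₁ m) , suc (proj₂ m))
    (ListP.∷-injectiveˡ eq) (mon-wt A gs hs (ListP.∷-injectiveʳ eq))

  idRetract : (A : MonAlg) → AlgebraRetract K A A
  idRetract A = id , id , idHom , idHom , λ _ _ → ≈-refl
    where
      idHom : IsHomHom K A A id
      idHom = record
        { cong  = λ _ _ p≈q → p≈q
        ; hom-+ = λ _ _ _ → ≈-refl
        ; hom-* = λ _ _ _ → ≈-refl
        ; hom-1 = λ _ → ≈-refl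
        ; hom-· = λ _ _ _ → ≈-refl
        ; homog = 1 , λ i p homog → subst (λ j → Poly.Homog K A j p) (sym (ℕP.*-identityˡ i)) homog
        }

  compHom : (A B C : MonAlg) (f : Poly.Elt K A → Poly.Elt K B) (g : Poly.Elt K B → Poly.Elt K C) →
    IsHomHom K A B f → IsHomHom K B C g → IsHomHom K A C (g ∘ f)
  compHom A B C f g homF homG = record
    { cong  = λ p q p≈q → G.cong _ _ (F.cong p q p≈q)
    ; hom-+ = λ p q m → ≈-trans (G.cong _ _ (F.hom-+ p q) m) (G.hom-+ _ _ m)
    ; hom-* = λ p q m → ≈-trans (G.cong _ _ (F.hom-* p q) m) (G.hom-* _ _ m)
    ; hom-1 = λ m → ≈-trans (G.cong _ _ F.hom-1 m) (G.hom-1 m)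
    ; hom-· = λ a p m → ≈-trans (G.cong _ _ (F.hom-· a p) m) (G.hom-· a (f p) m)
    ; homog = proj₁ G.homog ℕ.* proj₁ F.homog , λ i p homog →
        subst (λ j → Poly.Homog K C j (g (f p))) (sym (ℕP.*-assoc (proj₁ G.homog) (proj₁ F.homog) i))
              (proj₂ G.homog _ (f p) (proj₂ F.homog i p homog))
    }
    where
      module F = IsHomHom homF
      module G = IsHomHom homG

  compRetract : (A B C : MonAlg) → AlgebraRetract K A B → AlgebraRetract K B C → AlgebraRetract K A C
  compRetract A B C (ι₁ , γ₁ , homι₁ , homγ₁ , γι₁) (ι₂ , γ₂ , homι₂ , homγ₂ , γι₂) =
    ι₂ ∘ ι₁ , γ₁ ∘ γ₂ , compHom A B C ι₁ ι₂ homι₁ homι₂ , compHom C B A γ₂ γ₁ homγ₂ homγ₁ ,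
    λ p m → ≈-trans (IsHomHom.cong homγ₁ _ _ (γι₂ (ι₁ p)) m) (γι₁ p m)

  retract-from-sections : {A B : MonAlg} (ι : GeneratorMap A B) (γ : GeneratorMap B A) →
    (∀ g → ∃ λ h → GeneratorMap.image ι g ≡ just h ×
           ∃ λ g′ → GeneratorMap.image γ h ≡ just g′ × wt A g′ ≡ wt A g) →
    AlgebraRetract K A B
  retract-from-sections {A} {B} ι γ section =
    I.hom , G.hom , I.isHomHom , G.isHomHom , λ p m → subst (_≈ coeff p m) (sym (γι p m)) ≈-refl
    where
      module I = Induced K ι
      module G = Induced K γ
      open Poly K A using (coeff; mon; _≟M_)
      γι : ∀ p m → coeff (G.hom (I.hom p)) m ≡ coeff p m
      γι []             m = refl
      γι ((a , gs) ∷ p) m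
        with traverseMaybe-section (GeneratorMap.image ι) (GeneratorMap.image γ) (wt A) section gs
      ... | hs , gs↦ , gs′ , hs↦ , wt≡
        rewrite I.hom-∷ a gs p gs↦ | G.hom-∷ a hs (I.hom p) hs↦
        with mon gs′ ≟M m | mon gs ≟M m
      ... | yes _      | yes _      = cong (a +_) (γι p m)
      ... | no  _      | no  _      = γι p m
      ... | yes gs′≡m | no  gs≢m  = ⊥-elim (gs≢m (trans (sym (mon-wt A gs′ gs wt≡)) gs′≡m))
      ... | no  gs′≢m | yes gs≡m  = ⊥-elim (gs′≢m (trans (mon-wt A gs′ gs wt≡) gs≡m))

-- Cycle algebras of single-element deletions and contractions

-- The partner of e is the other element f of a series pair {e, f}, and nothing for a deletion or a
-- coloop contraction; a circuit C of M₁ lifts to C + e if f ∈ C, and to C otherwise.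

bit : Bool → ℕ
bit b = if b then 1 else 0

partnerIn : Maybe (Fin n) → Subset n → Bool
partnerIn nothing  X = false
partnerIn (just f) X = lookup X f

partnerCount : Maybe (Fin n) → Vec ℕ n → ℕ
partnerCount nothing  v = 0
partnerCount (just f) v = lookup v f

partnerIn-∪ : ∀ (partner : Maybe (Fin n)) X Y →
  partnerIn partner (X ∪ Y) ≡ partnerIn partner X ∨ partnerIn partner Y
partnerIn-∪ nothing  X Y = refl
partnerIn-∪ (just f) X Y = VecP.lookup-zipWith _∨_ f X Y

partnerIn-∩ : ∀ (partner : Maybe (Fin n)) X Y →
  partnerIn partner (X ∩ Y) ≡ partnerIn partner X ∧ partnerIn partner Y
partnerIn-∩ nothing  X Y = refl
partnerIn-∩ (just f) X Y = VecP.lookup-zipWith _∧_ f X Y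

partnerIn-⊥ : ∀ (partner : Maybe (Fin n)) → partnerIn partner ⊥ ≡ false
partnerIn-⊥ nothing  = refl
partnerIn-⊥ (just f) = VecP.lookup-replicate f false

partnerCount-+ : ∀ (partner : Maybe (Fin n)) u v →
  partnerCount partner (zipWith ℕ._+_ u v) ≡ partnerCount partner u ℕ.+ partnerCount partner v
partnerCount-+ nothing  u v = refl
partnerCount-+ (just f) u v = VecP.lookup-zipWith ℕ._+_ f u v

partnerCount-0 : ∀ (partner : Maybe (Fin n)) → partnerCount partner (replicate n 0) ≡ 0
partnerCount-0 nothing  = refl
partnerCount-0 (just f) = VecP.lookup-replicate f 0

partnerCount-indicator : ∀ (partner : Maybe (Fin n)) X →
  partnerCount partner (indicator X) ≡ bit (partnerIn partner X)
partnerCount-indicator nothing  X = refl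
partnerCount-indicator (just f) X = VecP.lookup-map f bit X

module Lift {n : ℕ} {M : Matroid (suc n)} {M₁ : Matroid n} (e : Fin (suc n)) (partner : Maybe (Fin n))
            (lift-circuit : ∀ C → Circuit M₁ C → Circuit M (insertAt C e (partnerIn partner C))) where

  lift : Subset n → Subset (suc n)
  lift X = insertAt X e (partnerIn partner X)

  lift-⊥ : lift ⊥ ≡ ⊥
  lift-⊥ = trans (cong (insertAt ⊥ e) (partnerIn-⊥ partner)) (insertAt-replicate false e)

  lift-∪ : ∀ X Y → lift (X ∪ Y) ≡ lift X ∪ lift Y
  lift-∪ X Y = trans (cong (insertAt (X ∪ Y) e) (partnerIn-∪ partner X Y))
                     (sym (zipWith-insertAt _∨_ X Y e _ _))

  lift-∩ : ∀ X Y → lift (X ∩ Y) ≡ lift X ∩ lift Y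
  lift-∩ X Y = trans (cong (insertAt (X ∩ Y) e) (partnerIn-∩ partner X Y))
                     (sym (zipWith-insertAt _∧_ X Y e _ _))

  lift-cycle : ∀ {C} → Cycle M₁ C → Cycle M (lift C)
  lift-cycle cyc-∅ = subst (Cycle M) (sym lift-⊥) cyc-∅
  lift-cycle (cyc-∪ {C} {D} circC cycD C∩D≡⊥) = subst (Cycle M) (sym (lift-∪ C D))
    (cyc-∪ (lift-circuit C circC) (lift-cycle cycD)
           (trans (sym (lift-∩ C D)) (trans (cong lift C∩D≡⊥) lift-⊥)))

  generatorMap : GeneratorMap (CycAlg M₁) (CycAlg M)
  generatorMap = record
    { exponents   = λ v → insertAt v e (partnerCount partner v)
    ; exponents-+ = λ u v → trans (cong (insertAt _ e) (partnerCount-+ partner u v))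
                                  (sym (zipWith-insertAt ℕ._+_ u v e _ _))
    ; exponents-0 = trans (cong (insertAt _ e) (partnerCount-0 partner)) (insertAt-replicate 0 e)
    ; vanishing   = λ _ → 0
    ; vanishing-+ = λ _ _ → refl
    ; vanishing-0 = refl
    ; image       = λ (C , cyc) → just (lift C , lift-cycle cyc)
    ; image-spec  = λ (C , cyc) → sent refl (trans (VecP.map-insertAt bit _ C e)
        (cong (insertAt (indicator C) e) (sym (partnerCount-indicator partner C))))
    }

  retract : ∀ {c ℓ} (K : Field c ℓ) (γ : GeneratorMap (CycAlg M) (CycAlg M₁)) →
    (∀ C (cyc : Cycle M₁ C) → ∃ λ h → GeneratorMap.image γ (lift C , lift-cycle cyc) ≡ just h × proj₁ h ≡ C) →
    AlgebraRetract K (CycAlg M₁) (CycAlg M)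
  retract K γ restricts = retract-from-sections K generatorMap γ λ (C , cyc) →
    let h , γ↦ , h≡C = restricts C cyc in _ , refl , h , γ↦ , cong indicator h≡C

restrict-∪ : (C D : Subset (suc n)) (e : Fin (suc n)) → removeAt (C ∪ D) e ≡ removeAt C e ∪ removeAt D e
restrict-∪ C D e = zipWith-removeAt _∨_ C D e

restrict-disjoint : (C D : Subset (suc n)) (e : Fin (suc n)) → C ∩ D ≡ ⊥ → removeAt C e ∩ removeAt D e ≡ ⊥
restrict-disjoint C D e C∩D≡⊥ =
  trans (sym (zipWith-removeAt _∧_ C D e))
        (trans (cong (λ X → removeAt X e) C∩D≡⊥) (removeAt-replicate false e))

-- Contracting e: y_e ↦ 1.
module Restriction {n : ℕ} {M : Matroid (suc n)} {M₁ : Matroid n} (e : Fin (suc n))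
                   (restrict-circuit : ∀ C → Circuit M C → Circuit M₁ (removeAt C e)) where

  restrict-cycle : ∀ {C} → Cycle M C → Cycle M₁ (removeAt C e)
  restrict-cycle cyc-∅ = subst (Cycle M₁) (sym (removeAt-replicate false e)) cyc-∅
  restrict-cycle (cyc-∪ {C} {D} circC cycD C∩D≡⊥) = subst (Cycle M₁) (sym (restrict-∪ C D e))
    (cyc-∪ (restrict-circuit C circC) (restrict-cycle cycD) (restrict-disjoint C D e C∩D≡⊥))

  generatorMap : GeneratorMap (CycAlg M) (CycAlg M₁)
  generatorMap = record
    { exponents   = λ v → removeAt v e
    ; exponents-+ = λ u v → zipWith-removeAt ℕ._+_ u v e
    ; exponents-0 = removeAt-replicate 0 e
    ; vanishing   = λ _ → 0
    ; vanishing-+ = λ _ _ → refl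
    ; vanishing-0 = refl
    ; image       = λ (C , cyc) → just (removeAt C e , restrict-cycle cyc)
    ; image-spec  = λ (C , cyc) → sent refl (map-removeAt bit C e)
    }

-- Deleting e: y_e ↦ 0, which kills exactly the cycles through e.
module RestrictionAvoiding {n : ℕ} {M : Matroid (suc n)} {M₁ : Matroid n} (e : Fin (suc n))
    (restrict-circuit : ∀ C → Circuit M C → lookup C e ≡ false → Circuit M₁ (removeAt C e)) where

  restrict-cycle : ∀ {C} → Cycle M C → lookup C e ≡ false → Cycle M₁ (removeAt C e)
  restrict-cycle cyc-∅ _ = subst (Cycle M₁) (sym (removeAt-replicate false e)) cyc-∅
  restrict-cycle (cyc-∪ {C} {D} circC cycD C∩D≡⊥) C∪De≡false = subst (Cycle M₁) (sym (restrict-∪ C D e))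
    (cyc-∪ (restrict-circuit C circC (BoolP.∨-conicalˡ _ _ Ce∨De≡false))
           (restrict-cycle cycD (BoolP.∨-conicalʳ _ _ Ce∨De≡false)) (restrict-disjoint C D e C∩D≡⊥))
    where Ce∨De≡false = trans (sym (VecP.lookup-zipWith _∨_ e C D)) C∪De≡false

  restrictOrKill : (C : Subset (suc n)) → Cycle M C → (b : Bool) → lookup C e ≡ b → Maybe (Gen (CycAlg M₁))
  restrictOrKill C cyc true  _  = nothing
  restrictOrKill C cyc false Ce = just (removeAt C e , restrict-cycle cyc Ce)

  restrictOrKill-spec : ∀ C cyc b (Ce : lookup C e ≡ b) →
    ImageSpec {CycAlg M} {CycAlg M₁} (λ v → removeAt v e) (λ v → lookup v e) (indicator C)
              (restrictOrKill C cyc b Ce)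
  restrictOrKill-spec C cyc true  Ce =
    killed λ eq → ℕP.1+n≢0 (trans (cong bit (sym Ce)) (trans (sym (VecP.lookup-map e bit C)) eq))
  restrictOrKill-spec C cyc false Ce =
    sent (trans (VecP.lookup-map e bit C) (cong bit Ce)) (map-removeAt bit C e)

  restrictOrKill-avoiding : ∀ C cyc b (Ce : lookup C e ≡ b) → b ≡ false →
    ∃ λ h → restrictOrKill C cyc b Ce ≡ just h × proj₁ h ≡ removeAt C e
  restrictOrKill-avoiding C cyc false Ce _ = _ , refl , refl

  generatorMap : GeneratorMap (CycAlg M) (CycAlg M₁)
  generatorMap = record
    { exponents   = λ v → removeAt v e
    ; exponents-+ = λ u v → zipWith-removeAt ℕ._+_ u v e
    ; exponents-0 = removeAt-replicate 0 e
    ; vanishing   = λ v → lookup v e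
    ; vanishing-+ = λ u v → VecP.lookup-zipWith ℕ._+_ e u v
    ; vanishing-0 = VecP.lookup-replicate e 0
    ; image       = λ (C , cyc) → restrictOrKill C cyc (lookup C e) refl
    ; image-spec  = λ (C , cyc) → restrictOrKill-spec C cyc (lookup C e) refl
    }

stepRetract : ∀ {c ℓ} (K : Field c ℓ) {n} {M : Matroid (suc n)} {M₁ : Matroid n} →
  Step M M₁ → AlgebraRetract K (CycAlg M₁) (CycAlg M)
stepRetract K {M = M} {M₁} (deletion e del) = L.retract K R.generatorMap λ C cyc →
  let h , image≡ , h≡ = R.restrictOrKill-avoiding (L.lift C) (L.lift-cycle cyc) _ refl
                           (VecP.insertAt-lookup C e false)
  in h , image≡ , trans h≡ (VecP.removeAt-insertAt C e false)
  where
    module L = Lift e nothing (Deletion.circuit⁺ M M₁ e del)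
    module R = RestrictionAvoiding e (Deletion.circuit⁻ M M₁ e del)
stepRetract K {M = M} {M₁} (seriesContr e (f , f≢e , cocircuit) con) =
  L.retract K R.generatorMap λ C cyc → _ , refl , VecP.removeAt-insertAt C e _
  where
    module S = SeriesContraction M M₁ e f≢e cocircuit con
    module L = Lift e (just S.f₁) S.lift-circuit
    module R = Restriction e S.restrict-circuit
stepRetract K {M = M} {M₁} (coloopContr e coloop con) =
  L.retract K R.generatorMap λ C cyc → _ , refl , VecP.removeAt-insertAt C e _
  where
    module C = ColoopContraction M M₁ e coloop con
    module L = Lift e nothing C.lift-circuit
    module R = Restriction e C.restrict-circuit

reachRetract : ∀ {c ℓ} (K : Field c ℓ) {n m} {M : Matroid n} {M′ : Matroid m} →
  Reach M M′ → AlgebraRetract K (CycAlg M′) (CycAlg M)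
reachRetract K {M = M} here = idRetract K (CycAlg M)
reachRetract K {M = M} {M′} (step {M₁ = M₁} s r) =
  compRetract K (CycAlg M′) (CycAlg M₁) (CycAlg M) (reachRetract K r) (stepRetract K s)

proposition4p4 : ∀ {c ℓ} (K : Field c ℓ) {n m} (M : Matroid n) (M' : Matroid m) →
    NonFree M → NonFree M' → Reach M M' →
    AlgebraRetract K (CycAlg M') (CycAlg M)
proposition4p4 K M M' _ _ = reachRetract K
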